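{- For $n=1,2,\ldots$, the partial endomorphism monoid of $\mathbf{Z}_{2n+1}$ is generated by the maps $f_0,\ldots,f_n,g$.
   Context: $\mathbf{Z}_{2n+1}$ is the Sugihara algebra on $\{ -n,\ldots,n\}$ (lattice order of integers, $\neg a=-a$, $a\to b=(-a)\vee b$ if $a\le b$, $(-a)\wedge b$ otherwise). Partial endomorphisms are homomorphisms from a subalgebra of $\mathbf{Z}_{2n+1}$ into $\mathbf{Z}_{2n+1}$, forming a monoid under composition (with the empty map added). $f_0$ is the identity on domain $\mathbf{Z}_{2n+1}\setminus\{0\}$; $f_1$ is the identity on domain $\mathbf{Z}_{2n+1}\setminus\{1,-1\}$; for $1<i\le n$, $f_i$ has domain $\mathbf{Z}_{2n+1}\setminus\{i,-i\}$, sends $i-1\mapsto i$, $-(i-1)\mapsto -i$ and fixes all other elements; $g$ is the (total) endomorphism with $g(a)=a-1$ for $a>0$, $g(a)=a+1$ for $a<0$, $g(0)=0$. -}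

module Defs where

open import Data.Bool using (Bool; true; false; if_then_else_; _∧_; _∨_; not)
open import Data.Nat as ℕ using (ℕ; zero; suc)
open import Data.Integer as ℤ using (ℤ; +_; -_; _⊓_; _⊔_; ∣_∣)
open import Data.Fin using (Fin; toℕ)
open import Data.List using (List; []; _∷_)
open import Data.Maybe using (Maybe; just; nothing; _>>=_)
open import Data.Product using (_×_)
open import Relation.Nullary.Decidable using (⌊_⌋)
open import Relation.Binary.PropositionalEquality using (_≡_)

-- The Sugihara algebra Z_{2n+1}: carrier {-n,...,n} ⊆ ℤ,
-- ∧ = min, ∨ = max, ¬a = -a,
-- a → b = (-a) ∨ b  if a ≤ b,   (-a) ∧ b  otherwise.

InZ : ℕ → ℤ → Set
InZ n a = ∣ a ∣ ℕ.≤ n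

inZ? : ℕ → ℤ → Bool
inZ? n a = ⌊ ∣ a ∣ ℕ.≤? n ⌋

_⇒_ : ℤ → ℤ → ℤ
a ⇒ b = if ⌊ a ℤ.≤? b ⌋ then (- a) ⊔ b else (- a) ⊓ b

PMap : Set
PMap = ℤ → Maybe ℤ

-- Partial endomorphism of Z_{2n+1}: domain and image lie in {-n,...,n},
-- the domain is closed under ∧, ∨, ¬, → (i.e. it is a subalgebra; the empty
-- domain gives the empty map), and h is a homomorphism on its domain.
record IsPartialEndo (n : ℕ) (h : PMap) : Set where
  field
    dom-in : ∀ a b → h a ≡ just b → InZ n a
    img-in : ∀ a b → h a ≡ just b → InZ n b
    pres-∧ : ∀ a a' b b' → h a ≡ just b → h a' ≡ just b' → h (a ⊓ a') ≡ just (b ⊓ b')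
    pres-∨ : ∀ a a' b b' → h a ≡ just b → h a' ≡ just b' → h (a ⊔ a') ≡ just (b ⊔ b')
    pres-¬ : ∀ a b → h a ≡ just b → h (- a) ≡ just (- b)
    pres-⇒ : ∀ a a' b b' → h a ≡ just b → h a' ≡ just b' → h (a ⇒ a') ≡ just (b ⇒ b')

idZ : ℕ → PMap
idZ n a = if inZ? n a then just a else nothing

_∘ₚ_ : PMap → PMap → PMap
(h ∘ₚ k) a = k a >>= h

eqℤ : ℤ → ℤ → Bool
eqℤ a b = ⌊ a ℤ.≟ b ⌋

fmap : ℕ → ℕ → PMap
fmap n zero a = if inZ? n a ∧ not (eqℤ a (+ 0)) then just a else nothing
fmap n (suc zero) a = if inZ? n a ∧ not (⌊ ∣ a ∣ ℕ.≟ 1 ⌋) then just a else nothing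
fmap n (suc (suc k)) a =
  if inZ? n a ∧ not (⌊ ∣ a ∣ ℕ.≟ suc (suc k) ⌋)
  then (if eqℤ a (+ suc k) then just (+ suc (suc k))
        else if eqℤ a (- (+ suc k)) then just (- (+ suc (suc k)))
        else just a)
  else nothing

gmap : ℕ → PMap
gmap n a = if inZ? n a
           then (if ⌊ + 0 ℤ.<? a ⌋ then just (a ℤ.- + 1)
                 else if ⌊ a ℤ.<? + 0 ⌋ then just (a ℤ.+ + 1)
                 else just (+ 0))
           else nothing

data Gen (n : ℕ) : Set where
  f : Fin (suc n) → Gen n
  g : Gen n

⟦_⟧ : {n : ℕ} → Gen n → PMap
⟦_⟧ {n} (f i) = fmap n (toℕ i)
⟦_⟧ {n} g = gmap n

evalWord : (n : ℕ) → List (Gen n) → PMap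
evalWord n [] = idZ n
evalWord n (x ∷ w) = ⟦ x ⟧ ∘ₚ evalWord n w

module Submission where

-- A partial endomorphism h commutes with negation and sends non-negative
-- elements to non-negative ones, so it is the odd extension of its half map
-- P : ℕ → Maybe ℕ; the same holds for every word in the generators.  The half
-- map of h is a half homomorphism: defined only on {0,…,n}, with values in
-- {0,…,n}, monotone, fixing 0, and identifying two points only by sending them
-- to 0 (by ∧, ¬ and → respectively).  So it suffices to write every half
-- homomorphism as a composite of half maps of generators, which is done by
-- three reductions, each splitting off generators:
--   1. a hole j in the domain is filled, at the cost of a factor f_0 (j = 0)
--      or of the shift word f_1 ∘ ⋯ ∘ f_j (j ≥ 1);
--   2. with domain {0,…,r} and 1 ↦ 0, P = P' ∘ g where P' has domain {0,…,r-1};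
--   3. otherwise P is strictly increasing; factors f_j lower its values until it
--      is the identity on {0,…,r}, which is g ∘ (f_1 ∘ ⋯ ∘ f_{r+1}) ∘ id_{r+1}.

open import Defs
open import Data.Bool using (if_then_else_; _∧_; not)
open import Data.Nat as ℕ using (ℕ; zero; suc; pred; _+_; _∸_; _≤_; _<_; z≤n; s≤s; _≤?_; _≟_)
open import Data.Nat.Properties
  using ( suc-injective; ≤-refl; ≤-trans; <-trans; <-≤-trans; ≤-<-trans; <-irrefl; <-asym; <-cmp
        ; <⇒≤; <⇒≱; <⇒≢; >⇒≢; ≰⇒>; ≤∧≢⇒<; ≤-pred; n<1+n; m<n⇒m<1+n; m≤n⇒m≤1+n
        ; m≤n⇒m<n∨m≡n; n≤0⇒n≡0; n≢0⇒n>0; pred[n]≤n; pred-mono-≤; m≤n+m; m∸n+n≡m; +-suc; +-identityʳ )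
open import Data.Integer as ℤ using (ℤ; +_; -[1+_]; -_)
import Data.Integer.Properties as ℤP
open import Data.Fin using (toℕ; fromℕ<)
open import Data.Fin.Properties using (toℕ-fromℕ<; toℕ≤pred[n])
open import Data.List using (List; []; _∷_; _++_)
open import Data.Maybe using (Maybe; just; nothing; _>>=_) renaming (map to mapₘ)
open import Data.Maybe.Properties using (just-injective)
open import Data.Product using (∃; _×_; _,_; proj₁; proj₂)
open import Data.Sum using (_⊎_; inj₁; inj₂)
open import Data.Empty using (⊥-elim)
open import Function using (_∘_)
open import Relation.Nullary using (yes; no)
open import Relation.Nullary.Decidable using (⌊_⌋)
open import Relation.Binary.Definitions using (Tri; tri<; tri≈; tri>)
open import Relation.Binary.PropositionalEquality

-- A half map is the action of a partial map on the non-negative half of ℤ.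
Half : Set
Half = ℕ → Maybe ℕ

Defined : Half → ℕ → Set
Defined P a = ∃ λ b → P a ≡ just b

FixesZero : Half → Set
FixesZero P = ∀ b → P 0 ≡ just b → b ≡ 0

-- f_j moves j - 1 to j when j ≥ 2 and fixes everything else.
push : ℕ → ℕ → ℕ
push (suc (suc k)) a = if ⌊ a ≟ suc k ⌋ then suc (suc k) else a
push _ a = a

opaque
  _∘ʰ_ : Half → Half → Half
  (P ∘ʰ Q) a = Q a >>= P

  restrict : ℕ → Half
  restrict r a = if ⌊ a ≤? r ⌋ then just a else nothing

  fHalf : ℕ → ℕ → Half
  fHalf n j a = if ⌊ a ≤? n ⌋ ∧ not ⌊ a ≟ j ⌋ then just (push j a) else nothing

  gHalf : ℕ → Half
  gHalf n a = if ⌊ a ≤? n ⌋ then just (pred a) else nothing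

  update : Half → ℕ → ℕ → Half
  update P s v a = if ⌊ a ≟ s ⌋ then just v else P a

half : {n : ℕ} → Gen n → Half
half {n} (f i) = fHalf n (toℕ i)
half {n} g = gHalf n

evalHalf : (n : ℕ) → List (Gen n) → Half
evalHalf n [] = restrict n
evalHalf n (x ∷ w) = half x ∘ʰ evalHalf n w

pos neg : ℕ → ℤ
pos b = + b
neg b = - (+ b)

extend : Half → PMap
extend P (+ a) = mapₘ pos (P a)
extend P -[1+ a ] = mapₘ neg (P (suc a))

extend-cong : ∀ {P Q} → P ≗ Q → extend P ≗ extend Q
extend-cong P≗Q (+ a) = cong (mapₘ pos) (P≗Q a)
extend-cong P≗Q -[1+ a ] = cong (mapₘ neg) (P≗Q (suc a))

extend-neg : ∀ {P} → FixesZero P → ∀ a → extend P (neg a) ≡ mapₘ neg (P a)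
extend-neg {P} fix zero = at-zero (P 0) fix
  where
  at-zero : (m : Maybe ℕ) → (∀ b → m ≡ just b → b ≡ 0) → mapₘ pos m ≡ mapₘ neg m
  at-zero nothing _ = refl
  at-zero (just b) is-zero rewrite is-zero b refl = refl
extend-neg fix (suc a) = refl

opaque
  unfolding _∘ʰ_

  extend-∘ : ∀ {H K : PMap} {P Q : Half} → FixesZero P →
             H ≗ extend P → K ≗ extend Q → (H ∘ₚ K) ≗ extend (P ∘ʰ Q)
  extend-∘ {Q = Q} fix H≗ K≗ (+ a) rewrite K≗ (+ a) with Q a
  ... | nothing = refl
  ... | just b = H≗ (+ b)
  extend-∘ {Q = Q} fix H≗ K≗ -[1+ a ] rewrite K≗ -[1+ a ] with Q (suc a)
  ... | nothing = refl
  ... | just b = trans (H≗ (neg b)) (extend-neg fix b)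

opaque
  unfolding fHalf gHalf restrict

  fmap-extend : ∀ n j → fmap n j ≗ extend (fHalf n j)
  fmap-extend n zero (+ a) with a ≤? n | a ≟ 0
  ... | no _ | _ = refl
  ... | yes _ | yes _ = refl
  ... | yes _ | no _ = refl
  fmap-extend n zero -[1+ a ] with suc a ≤? n
  ... | no _ = refl
  ... | yes _ = refl
  fmap-extend n (suc zero) (+ a) with a ≤? n | a ≟ 1
  ... | no _ | _ = refl
  ... | yes _ | yes _ = refl
  ... | yes _ | no _ = refl
  fmap-extend n (suc zero) -[1+ a ] with suc a ≤? n | suc a ≟ 1
  ... | no _ | _ = refl
  ... | yes _ | yes _ = refl
  ... | yes _ | no _ = refl
  fmap-extend n (suc (suc k)) (+ a) with a ≤? n | a ≟ suc (suc k) | a ≟ suc k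
  ... | no _ | _ | _ = refl
  ... | yes _ | yes _ | _ = refl
  ... | yes _ | no _ | yes _ = refl
  ... | yes _ | no _ | no _ = refl
  fmap-extend n (suc (suc k)) -[1+ a ]
    with suc a ≤? n | suc a ≟ suc (suc k) | a ≟ k | suc a ≟ suc k
  ... | no _ | _ | _ | _ = refl
  ... | yes _ | yes _ | _ | _ = refl
  ... | yes _ | no _ | yes _ | yes _ = refl
  ... | yes _ | no _ | no _ | no _ = refl
  ... | yes _ | no _ | yes a≡k | no a≢k = ⊥-elim (a≢k (cong suc a≡k))
  ... | yes _ | no _ | no a≢k | yes a≡k = ⊥-elim (a≢k (suc-injective a≡k))

  gmap-extend : ∀ n → gmap n ≗ extend (gHalf n)
  gmap-extend n (+ zero) with 0 ≤? n
  ... | no _ = refl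
  ... | yes _ = refl
  gmap-extend n (+ suc a) with suc a ≤? n
  ... | no _ = refl
  ... | yes _ = refl
  gmap-extend n -[1+ zero ] with 1 ≤? n
  ... | no _ = refl
  ... | yes _ = refl
  gmap-extend n -[1+ suc a ] with suc (suc a) ≤? n
  ... | no _ = refl
  ... | yes _ = refl

  idZ-extend : ∀ n → idZ n ≗ extend (restrict n)
  idZ-extend n (+ a) with a ≤? n
  ... | no _ = refl
  ... | yes _ = refl
  idZ-extend n -[1+ a ] with suc a ≤? n
  ... | no _ = refl
  ... | yes _ = refl

  half-fixes-zero : ∀ {n} (x : Gen n) → FixesZero (half x)
  half-fixes-zero {n} (f i) = fHalf-fixes-zero (toℕ i)
    where
    fHalf-fixes-zero : ∀ j → FixesZero (fHalf n j)
    fHalf-fixes-zero zero b ()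
    fHalf-fixes-zero (suc zero) b refl = refl
    fHalf-fixes-zero (suc (suc k)) b refl = refl
  half-fixes-zero {n} g b refl = refl

half-extend : ∀ {n} (x : Gen n) → ⟦ x ⟧ ≗ extend (half x)
half-extend {n} (f i) = fmap-extend n (toℕ i)
half-extend {n} g = gmap-extend n

evalWord-extend : ∀ n w → evalWord n w ≗ extend (evalHalf n w)
evalWord-extend n [] = idZ-extend n
evalWord-extend n (x ∷ w) =
  extend-∘ (half-fixes-zero x) (half-extend x) (evalWord-extend n w)

record IsHalfHom (n : ℕ) (P : Half) : Set where
  field
    dom-bound : ∀ a b → P a ≡ just b → a ≤ n
    img-bound : ∀ a b → P a ≡ just b → b ≤ n
    fixes-zero : FixesZero P
    monotone : ∀ a a' b b' → P a ≡ just b → P a' ≡ just b' → a ≤ a' → b ≤ b'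
    collapses-to-zero : ∀ a a' b → P a ≡ just b → P a' ≡ just b → a < a' → b ≡ 0

hom-above : ∀ {n P} → IsHalfHom n P → ∀ {a} → n < a → P a ≡ nothing
hom-above {P = P} hom {a} n<a with P a in Pa
... | nothing = refl
... | just b = ⊥-elim (<⇒≱ n<a (IsHalfHom.dom-bound hom a b Pa))

positivePart : PMap → Half
positivePart h a = mapₘ ℤ.∣_∣ (h (+ a))

neg-fixed : ∀ b → neg b ≡ + b → b ≡ 0
neg-fixed zero _ = refl
neg-fixed (suc b) ()

⇒-refl : ∀ b → (+ b) ⇒ (+ b) ≡ + b
⇒-refl b with + b ℤ.≤? + b
... | yes _ = ℤP.i≤j⇒i⊔j≡j ℤP.neg-≤-pos
... | no b≰b = ⊥-elim (b≰b ℤP.≤-refl)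

⇒-down : ∀ {a a'} → a < a' → (+ a') ⇒ (+ a) ≡ neg a'
⇒-down {a} {a'} a<a' with + a' ℤ.≤? + a
... | yes a'≤a = ⊥-elim (<⇒≱ a<a' (ℤP.drop‿+≤+ a'≤a))
... | no _ = ℤP.i≤j⇒i⊓j≡i ℤP.neg-≤-pos

module PartialEndo {n : ℕ} {h : PMap} (pe : IsPartialEndo n h) where
  open IsPartialEndo pe

  -- h preserves the order, because it preserves meets.
  h-monotone : ∀ {a a' b b'} → a ℤ.≤ a' → h a ≡ just b → h a' ≡ just b' → b ℤ.≤ b'
  h-monotone {a} {a'} {b} {b'} a≤a' ha ha' = subst (ℤ._≤ b') (sym b≡b⊓b') (ℤP.i⊓j≤j b b')
    where
    b≡b⊓b' : b ≡ b ℤ.⊓ b'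
    b≡b⊓b' = just-injective
      (trans (sym ha) (trans (cong h (sym (ℤP.i≤j⇒i⊓j≡i a≤a'))) (pres-∧ a a' b b' ha ha')))

  -- Non-negative elements have non-negative images, since -c = h (-a) ≤ h a = c.
  nonneg↦nonneg : ∀ a c → h (+ a) ≡ just c → c ≡ + ℤ.∣ c ∣
  nonneg↦nonneg a (+ m) _ = refl
  nonneg↦nonneg a -[1+ m ] ha with h-monotone ℤP.neg-≤-pos (pres-¬ (+ a) -[1+ m ] ha) ha
  ... | ()

  positivePart-just : ∀ a b → positivePart h a ≡ just b → h (+ a) ≡ just (+ b)
  positivePart-just a b eq with h (+ a) in ha
  positivePart-just a b refl | just c = cong just (nonneg↦nonneg a c ha)

  -- h is determined by its positive part, because it commutes with negation.
  h-extend : h ≗ extend (positivePart h)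
  h-extend (+ a) with h (+ a) in ha
  ... | nothing = refl
  ... | just c = cong just (nonneg↦nonneg a c ha)
  h-extend -[1+ a ] with h (+ suc a) in ha
  ... | just c = trans (pres-¬ (+ suc a) c ha) (cong (λ c → just (- c)) (nonneg↦nonneg (suc a) c ha))
  ... | nothing with h -[1+ a ] in ha'
  ...   | nothing = refl
  ...   | just d with trans (sym (pres-¬ -[1+ a ] d ha')) ha
  ...     | ()

  positivePart-hom : IsHalfHom n (positivePart h)
  positivePart-hom = record
    { dom-bound = λ a b eq → dom-in (+ a) (+ b) (positivePart-just a b eq)
    ; img-bound = λ a b eq → img-in (+ a) (+ b) (positivePart-just a b eq)
    ; fixes-zero = fixes-zero
    ; monotone = λ a a' b b' eq eq' a≤a' → ℤP.drop‿+≤+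
        (h-monotone (ℤ.+≤+ a≤a') (positivePart-just a b eq) (positivePart-just a' b' eq'))
    ; collapses-to-zero = collapses-to-zero
    }
    where
    -- h 0 = h (-0) = -(h 0)
    fixes-zero : FixesZero (positivePart h)
    fixes-zero b eq = neg-fixed b (just-injective (trans (sym (pres-¬ (+ 0) (+ b) h0)) h0))
      where h0 = positivePart-just 0 b eq
    collapses-to-zero : ∀ a a' b → positivePart h a ≡ just b → positivePart h a' ≡ just b →
                        a < a' → b ≡ 0
    collapses-to-zero a a' b eq eq' a<a' = neg-fixed b (just-injective (begin
      just (neg b)          ≡⟨ sym (pres-¬ (+ a') (+ b) ha') ⟩
      h (neg a')            ≡⟨ cong h (sym (⇒-down a<a')) ⟩
      h ((+ a') ⇒ (+ a))    ≡⟨ pres-⇒ (+ a') (+ a) (+ b) (+ b) ha' ha ⟩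
      just ((+ b) ⇒ (+ b))  ≡⟨ cong just (⇒-refl b) ⟩
      just (+ b)            ∎))
      where
      open ≡-Reasoning
      ha = positivePart-just a b eq
      ha' = positivePart-just a' b eq'

opaque
  unfolding _∘ʰ_

  ∘ʰ-just : ∀ {P Q : Half} {a b} → Q a ≡ just b → (P ∘ʰ Q) a ≡ P b
  ∘ʰ-just eq rewrite eq = refl

  ∘ʰ-nothing : ∀ {P Q : Half} {a} → Q a ≡ nothing → (P ∘ʰ Q) a ≡ nothing
  ∘ʰ-nothing eq rewrite eq = refl

  ∘ʰ-just⁻¹ : ∀ {P Q : Half} {a b} → (P ∘ʰ Q) a ≡ just b →
              ∃ λ c → Q a ≡ just c × P c ≡ just b
  ∘ʰ-just⁻¹ {Q = Q} {a} eq with Q a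
  ... | just c = c , refl , eq

  ∘ʰ-cong : ∀ {P P' Q Q'} → P ≗ P' → Q ≗ Q' → P ∘ʰ Q ≗ P' ∘ʰ Q'
  ∘ʰ-cong {Q' = Q'} P≗P' Q≗Q' a rewrite Q≗Q' a with Q' a
  ... | nothing = refl
  ... | just b = P≗P' b

  ∘ʰ-assoc : ∀ P Q R → (P ∘ʰ Q) ∘ʰ R ≗ P ∘ʰ (Q ∘ʰ R)
  ∘ʰ-assoc P Q R a with R a
  ... | nothing = refl
  ... | just b = refl

opaque
  unfolding restrict

  restrict-in : ∀ {r a} → a ≤ r → restrict r a ≡ just a
  restrict-in {r} {a} a≤r with a ≤? r
  ... | yes _ = refl
  ... | no a≰r = ⊥-elim (a≰r a≤r)

  restrict-above : ∀ {r a} → r < a → restrict r a ≡ nothing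
  restrict-above {r} {a} r<a with a ≤? r
  ... | yes a≤r = ⊥-elim (<⇒≱ r<a a≤r)
  ... | no _ = refl

  restrict-just⁻¹ : ∀ {r a b} → restrict r a ≡ just b → b ≤ r
  restrict-just⁻¹ {r} {a} eq with a ≤? r
  restrict-just⁻¹ refl | yes a≤r = a≤r

opaque
  unfolding update

  update-here : ∀ {P s v} → update P s v s ≡ just v
  update-here {s = s} with s ≟ s
  ... | yes _ = refl
  ... | no s≢s = ⊥-elim (s≢s refl)

  update-there : ∀ {P s v a} → a ≢ s → update P s v a ≡ P a
  update-there {s = s} {a = a} a≢s with a ≟ s
  ... | yes a≡s = ⊥-elim (a≢s a≡s)
  ... | no _ = refl

update-just⁻¹ : ∀ {P s v a b} → update P s v a ≡ just b →
                (a ≡ s × b ≡ v) ⊎ (a ≢ s × P a ≡ just b)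
update-just⁻¹ {s = s} {a = a} eq with a ≟ s
... | yes refl = inj₁ (refl , just-injective (trans (sym eq) update-here))
... | no a≢s = inj₂ (a≢s , trans (sym (update-there a≢s)) eq)

module _ {n : ℕ} where
  opaque
    unfolding fHalf

    fHalf-above : ∀ j {a} → n < a → fHalf n j a ≡ nothing
    fHalf-above j {a} n<a with a ≤? n
    ... | yes a≤n = ⊥-elim (<⇒≱ n<a a≤n)
    ... | no _ = refl

    fHalf-kill : ∀ j → fHalf n j j ≡ nothing
    fHalf-kill j with j ≤? n | j ≟ j
    ... | no _ | _ = refl
    ... | yes _ | yes _ = refl
    ... | yes _ | no j≢j = ⊥-elim (j≢j refl)

    fHalf-fix-≢ : ∀ j {a} → a ≤ n → a ≢ j → suc a ≢ j → fHalf n j a ≡ just a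
    fHalf-fix-≢ zero {a} a≤n a≢j _ with a ≤? n | a ≟ 0
    ... | no a≰n | _ = ⊥-elim (a≰n a≤n)
    ... | yes _ | yes a≡j = ⊥-elim (a≢j a≡j)
    ... | yes _ | no _ = refl
    fHalf-fix-≢ (suc zero) {a} a≤n a≢j _ with a ≤? n | a ≟ 1
    ... | no a≰n | _ = ⊥-elim (a≰n a≤n)
    ... | yes _ | yes a≡j = ⊥-elim (a≢j a≡j)
    ... | yes _ | no _ = refl
    fHalf-fix-≢ (suc (suc k)) {a} a≤n a≢j 1+a≢j with a ≤? n | a ≟ suc (suc k) | a ≟ suc k
    ... | no a≰n | _ | _ = ⊥-elim (a≰n a≤n)
    ... | yes _ | yes a≡j | _ = ⊥-elim (a≢j a≡j)
    ... | yes _ | no _ | yes refl = ⊥-elim (1+a≢j refl)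
    ... | yes _ | no _ | no _ = refl

    fHalf-fix-zero : ∀ j → fHalf n (suc j) 0 ≡ just 0
    fHalf-fix-zero zero = refl
    fHalf-fix-zero (suc j) = refl

    fHalf-move : ∀ {a} → 1 ≤ a → suc a ≤ n → fHalf n (suc a) a ≡ just (suc a)
    fHalf-move {suc a} _ 2+a≤n with suc a ≤? n | suc a ≟ suc (suc a) | suc a ≟ suc a
    ... | no 1+a≰n | _ | _ = ⊥-elim (1+a≰n (<⇒≤ 2+a≤n))
    ... | yes _ | yes 1+a≡2+a | _ = ⊥-elim (<⇒≢ (n<1+n (suc a)) 1+a≡2+a)
    ... | yes _ | no _ | no 1+a≢1+a = ⊥-elim (1+a≢1+a refl)
    ... | yes _ | no _ | yes _ = refl

    fHalf-image : ∀ {j a b} → j ≤ n → fHalf n j a ≡ just b → b ≤ n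
    fHalf-image {j} {a} j≤n eq with a ≤? n | a ≟ j
    fHalf-image {zero} j≤n refl | yes a≤n | no _ = a≤n
    fHalf-image {suc zero} j≤n refl | yes a≤n | no _ = a≤n
    fHalf-image {suc (suc k)} {a} j≤n eq | yes a≤n | no _ with a ≟ suc k
    fHalf-image {suc (suc k)} j≤n refl | yes a≤n | no _ | yes _ = j≤n
    fHalf-image {suc (suc k)} j≤n refl | yes a≤n | no _ | no _ = a≤n

  fHalf-fix : ∀ j {a} → a ≤ n → suc a < j ⊎ j < a → fHalf n j a ≡ just a
  fHalf-fix j a≤n (inj₁ 1+a<j) = fHalf-fix-≢ j a≤n (<⇒≢ (<-trans (n<1+n _) 1+a<j)) (<⇒≢ 1+a<j)
  fHalf-fix j a≤n (inj₂ j<a) = fHalf-fix-≢ j a≤n (>⇒≢ j<a) (>⇒≢ (m<n⇒m<1+n j<a))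

  opaque
    unfolding gHalf

    gHalf-in : ∀ {a} → a ≤ n → gHalf n a ≡ just (pred a)
    gHalf-in {a} a≤n with a ≤? n
    ... | yes _ = refl
    ... | no a≰n = ⊥-elim (a≰n a≤n)

    gHalf-above : ∀ {a} → n < a → gHalf n a ≡ nothing
    gHalf-above {a} n<a with a ≤? n
    ... | yes a≤n = ⊥-elim (<⇒≱ n<a a≤n)
    ... | no _ = refl

    gHalf-image : ∀ {a b} → gHalf n a ≡ just b → b ≤ n
    gHalf-image {a} eq with a ≤? n
    gHalf-image {a} refl | yes a≤n = ≤-trans pred[n]≤n a≤n

  half-above : ∀ (x : Gen n) {a} → n < a → half x a ≡ nothing
  half-above (f i) = fHalf-above (toℕ i)
  half-above g = gHalf-above

  half-image : ∀ (x : Gen n) {a b} → half x a ≡ just b → b ≤ n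
  half-image (f i) = fHalf-image (toℕ≤pred[n] i)
  half-image g = gHalf-image

Generated : ℕ → Half → Set
Generated n P = ∃ λ (w : List (Gen n)) → P ≗ evalHalf n w

-- Words only produce values in {0,…,n}, so the identity ending a word can be
-- dropped; hence concatenation of words is composition.
evalHalf-image : ∀ n w {a b} → evalHalf n w a ≡ just b → b ≤ n
evalHalf-image n [] eq = restrict-just⁻¹ eq
evalHalf-image n (x ∷ w) eq with ∘ʰ-just⁻¹ {half x} {evalHalf n w} eq
... | _ , _ , xc≡b = half-image x xc≡b

evalHalf-++ : ∀ n w₁ w₂ → evalHalf n (w₁ ++ w₂) ≗ evalHalf n w₁ ∘ʰ evalHalf n w₂
evalHalf-++ n [] w₂ a with evalHalf n w₂ a in eq
... | nothing = sym (∘ʰ-nothing {restrict n} eq)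
... | just b = sym (trans (∘ʰ-just {restrict n} eq) (restrict-in (evalHalf-image n w₂ eq)))
evalHalf-++ n (x ∷ w₁) w₂ a = begin
  (half x ∘ʰ evalHalf n (w₁ ++ w₂)) a
    ≡⟨ ∘ʰ-cong (λ _ → refl) (evalHalf-++ n w₁ w₂) a ⟩
  (half x ∘ʰ (evalHalf n w₁ ∘ʰ evalHalf n w₂)) a
    ≡⟨ sym (∘ʰ-assoc (half x) (evalHalf n w₁) (evalHalf n w₂) a) ⟩
  ((half x ∘ʰ evalHalf n w₁) ∘ʰ evalHalf n w₂) a
    ∎
  where open ≡-Reasoning

generated-≗ : ∀ {n P Q} → P ≗ Q → Generated n Q → Generated n P
generated-≗ P≗Q (w , Q≗w) = w , λ a → trans (P≗Q a) (Q≗w a)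

generated-∘ : ∀ {n P Q} → Generated n P → Generated n Q → Generated n (P ∘ʰ Q)
generated-∘ {n} (w₁ , P≗w₁) (w₂ , Q≗w₂) =
  w₁ ++ w₂ , λ a → trans (∘ʰ-cong P≗w₁ Q≗w₂ a) (sym (evalHalf-++ n w₁ w₂ a))

generated-half : ∀ {n} (x : Gen n) → Generated n (half x)
generated-half {n} x = x ∷ [] , half≗
  where
  half≗ : half x ≗ half x ∘ʰ restrict n
  half≗ a with a ≤? n
  ... | yes a≤n = sym (∘ʰ-just (restrict-in a≤n))
  ... | no a≰n = trans (half-above x (≰⇒> a≰n)) (sym (∘ʰ-nothing (restrict-above (≰⇒> a≰n))))

generated-f : ∀ {n j} → j ≤ n → Generated n (fHalf n j)
generated-f {n} {j} j≤n = subst (λ i → Generated n (fHalf n i)) (toℕ-fromℕ< (s≤s j≤n))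
  (generated-half (f (fromℕ< (s≤s j≤n))))

generated-g : ∀ {n} → Generated n (gHalf n)
generated-g = generated-half g

-- The shift word f_1 ∘ f_2 ∘ … ∘ f_{k+1}: it moves each a ∈ {1,…,k} to a + 1,
-- is undefined at k + 1 and fixes 0 and every a ∈ {k+2,…,n}.
shift : ℕ → ℕ → Half
shift n zero = fHalf n 1
shift n (suc k) = shift n k ∘ʰ fHalf n (suc (suc k))

module _ {n : ℕ} where

  shift-zero : ∀ k → shift n k 0 ≡ just 0
  shift-zero zero = fHalf-fix-zero 0
  shift-zero (suc k) = trans (∘ʰ-just (fHalf-fix-zero (suc k))) (shift-zero k)

  shift-gap : ∀ k → shift n k (suc k) ≡ nothing
  shift-gap zero = fHalf-kill 1
  shift-gap (suc k) = ∘ʰ-nothing (fHalf-kill (suc (suc k)))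

  shift-above : ∀ k {a} → n < a → shift n k a ≡ nothing
  shift-above zero n<a = fHalf-above 1 n<a
  shift-above (suc k) n<a = ∘ʰ-nothing (fHalf-above (suc (suc k)) n<a)

  shift-high : ∀ k {a} → suc k < a → a ≤ n → shift n k a ≡ just a
  shift-high zero 1<a a≤n = fHalf-fix 1 a≤n (inj₂ 1<a)
  shift-high (suc k) 2+k<a a≤n =
    trans (∘ʰ-just (fHalf-fix (suc (suc k)) a≤n (inj₂ 2+k<a)))
          (shift-high k (<-trans (n<1+n _) 2+k<a) a≤n)

  shift-low : ∀ k {a} → suc k ≤ n → 1 ≤ a → a ≤ k → shift n k a ≡ just (suc a)
  shift-low zero _ 1≤a a≤0 = ⊥-elim (<⇒≱ 1≤a a≤0)
  shift-low (suc k) {a} 2+k≤n 1≤a a≤1+k with a ≟ suc k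
  ... | yes refl = trans (∘ʰ-just (fHalf-move 1≤a 2+k≤n)) (shift-high k ≤-refl 2+k≤n)
  ... | no a≢1+k = trans (∘ʰ-just (fHalf-fix (suc (suc k)) a≤n (inj₁ (s≤s a<1+k))))
                         (shift-low k (<⇒≤ 2+k≤n) 1≤a (≤-pred a<1+k))
    where
    a<1+k = ≤∧≢⇒< a≤1+k a≢1+k
    a≤n = ≤-trans a≤1+k (<⇒≤ 2+k≤n)

generated-shift : ∀ {n} k → suc k ≤ n → Generated n (shift n k)
generated-shift zero 1≤n = generated-f 1≤n
generated-shift (suc k) 2+k≤n = generated-∘ (generated-shift k (<⇒≤ 2+k≤n)) (generated-f 2+k≤n)

restrict-unfold : ∀ {n r} → r < n → restrict r ≗ gHalf n ∘ʰ (shift n r ∘ʰ restrict (suc r))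
restrict-unfold {n} {r} r<n a = by-cases (<-cmp a (suc r))
  where
  back : ∀ a → a ≤ r → (gHalf n ∘ʰ shift n r) a ≡ just a
  back zero _ = trans (∘ʰ-just (shift-zero r)) (gHalf-in z≤n)
  back (suc a) 1+a≤r =
    trans (∘ʰ-just (shift-low r r<n (s≤s z≤n) 1+a≤r)) (gHalf-in (≤-trans (s≤s 1+a≤r) r<n))
  rhs = gHalf n ∘ʰ (shift n r ∘ʰ restrict (suc r))
  by-cases : Tri (a < suc r) (a ≡ suc r) (suc r < a) → restrict r a ≡ rhs a
  by-cases (tri< a<1+r _ _) = begin
    restrict r a                                    ≡⟨ restrict-in (≤-pred a<1+r) ⟩
    just a                                          ≡⟨ sym (back a (≤-pred a<1+r)) ⟩
    (gHalf n ∘ʰ shift n r) a                        ≡⟨ sym (∘ʰ-just (restrict-in (<⇒≤ a<1+r))) ⟩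
    ((gHalf n ∘ʰ shift n r) ∘ʰ restrict (suc r)) a  ≡⟨ ∘ʰ-assoc _ _ _ a ⟩
    rhs a                                           ∎
    where open ≡-Reasoning
  by-cases (tri≈ _ refl _) = trans (restrict-above (n<1+n r))
    (sym (∘ʰ-nothing (trans (∘ʰ-just (restrict-in ≤-refl)) (shift-gap r))))
  by-cases (tri> _ _ 1+r<a) = trans (restrict-above (<-trans (n<1+n r) 1+r<a))
    (sym (∘ʰ-nothing (∘ʰ-nothing (restrict-above 1+r<a))))

-- Hence all restricted identities are generated, starting from the empty word (r = n).
restrict-generated : ∀ {n r} → r ≤ n → Generated n (restrict r)
restrict-generated {n} {r} r≤n = go (n ∸ r) (m∸n+n≡m r≤n)
  where
  go : ∀ d {r} → d + r ≡ n → Generated n (restrict r)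
  go zero refl = [] , λ _ → refl
  go (suc d) {r} d+r≡n = generated-≗ (restrict-unfold r<n)
    (generated-∘ generated-g (generated-∘ (generated-shift r r<n) (go d (trans (+-suc d r) d+r≡n))))
    where
    r<n : r < n
    r<n = subst (r <_) d+r≡n (s≤s (m≤n+m r d))

record HasDomain (r : ℕ) (P : Half) : Set where
  field
    defined : ∀ a → a ≤ r → Defined P a
    undefined : ∀ a → r < a → P a ≡ nothing

record StrictlyIncreasing (n r : ℕ) (Q : Half) : Set where
  field
    domain : HasDomain r Q
    zero↦zero : Q 0 ≡ just 0
    img-bound : ∀ a b → Q a ≡ just b → b ≤ n
    strict : ∀ a a' b b' → a < a' → Q a ≡ just b → Q a' ≡ just b' → b < b'
  open HasDomain domain public

domain-bound : ∀ {r P a b} → HasDomain r P → P a ≡ just b → a ≤ r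
domain-bound {r} {a = a} dom Pa with a ≤? r
... | yes a≤r = a≤r
... | no a≰r with trans (sym Pa) (HasDomain.undefined dom a (≰⇒> a≰r))
...   | ()

domain-fixes-zero : ∀ {n r P} → IsHalfHom n P → HasDomain r P → P 0 ≡ just 0
domain-fixes-zero hom dom with HasDomain.defined dom 0 z≤n
... | b , P0 = trans P0 (cong just (IsHalfHom.fixes-zero hom b P0))

FixesBelow : ℕ → Half → Set
FixesBelow s Q = ∀ a → a < s → Q a ≡ just a

above-diagonal : ∀ {n r s v Q} → StrictlyIncreasing n r Q → FixesBelow s Q → Q s ≡ just v → s ≤ v
above-diagonal {s = zero} _ _ _ = z≤n
above-diagonal {s = suc s} inc fix Qs = StrictlyIncreasing.strict inc s (suc s) s _ ≤-refl (fix s ≤-refl) Qs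

-- If Q fixes {0,…,s-1} and sends s to c + 1 > s, then lowering the value at s
-- to c gives a strictly increasing Q' with Q = f_{c+1} ∘ Q'.
module Lowering {n r s c : ℕ} {Q : Half} (inc : StrictlyIncreasing n r Q) (fix : FixesBelow s Q)
                (s≤r : s ≤ r) (s≤c : s ≤ c) (Qs : Q s ≡ just (suc c)) where
  open StrictlyIncreasing inc

  Q' : Half
  Q' = update Q s c

  1+c≤n : suc c ≤ n
  1+c≤n = img-bound s (suc c) Qs

  s≢0 : s ≢ 0
  s≢0 refl with trans (sym zero↦zero) Qs
  ... | ()

  1≤c : 1 ≤ c
  1≤c = ≤-trans (n≢0⇒n>0 s≢0) s≤c

  away : ∀ {a v} → a ≢ s → Q a ≡ just v → (a < s × v ≡ a) ⊎ (s < a × suc c < v)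
  away {a} a≢s Qa with <-cmp a s
  ... | tri< a<s _ _ = inj₁ (a<s , just-injective (trans (sym Qa) (fix a a<s)))
  ... | tri≈ _ a≡s _ = ⊥-elim (a≢s a≡s)
  ... | tri> _ _ s<a = inj₂ (s<a , strict s a (suc c) _ s<a Qs Qa)

  factor : Q ≗ fHalf n (suc c) ∘ʰ Q'
  factor a with a ≟ s
  ... | yes refl = trans Qs (sym (trans (∘ʰ-just update-here) (fHalf-move 1≤c 1+c≤n)))
  ... | no a≢s with Q a in Qa
  ...   | nothing = sym (∘ʰ-nothing (trans (update-there a≢s) Qa))
  ...   | just v =
    sym (trans (∘ʰ-just (trans (update-there a≢s) Qa)) (fHalf-fix (suc c) (img-bound a v Qa) far))
    where
    far : suc v < suc c ⊎ suc c < v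
    far with away a≢s Qa
    ... | inj₁ (a<s , refl) = inj₁ (s≤s (<-≤-trans a<s s≤c))
    ... | inj₂ (_ , 1+c<v) = inj₂ 1+c<v

  lowered-at : Q' s ≡ just c
  lowered-at = update-here

  lowered-fixes : FixesBelow s Q'
  lowered-fixes a a<s = trans (update-there (<⇒≢ a<s)) (fix a a<s)

  lowered-increasing : StrictlyIncreasing n r Q'
  lowered-increasing = record
    { domain = record { defined = defined' ; undefined = undefined' }
    ; zero↦zero = trans (update-there (s≢0 ∘ sym)) zero↦zero
    ; img-bound = img-bound'
    ; strict = strict'
    }
    where
    defined' : ∀ a → a ≤ r → Defined Q' a
    defined' a a≤r with a ≟ s
    ... | yes refl = c , update-here
    ... | no a≢s = let (v , Qa) = defined a a≤r in v , trans (update-there a≢s) Qa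
    undefined' : ∀ a → r < a → Q' a ≡ nothing
    undefined' a r<a = trans (update-there (>⇒≢ (≤-<-trans s≤r r<a))) (undefined a r<a)
    img-bound' : ∀ a b → Q' a ≡ just b → b ≤ n
    img-bound' a b eq with update-just⁻¹ eq
    ... | inj₁ (_ , refl) = <⇒≤ 1+c≤n
    ... | inj₂ (_ , Qa) = img-bound a b Qa
    strict' : ∀ a a' b b' → a < a' → Q' a ≡ just b → Q' a' ≡ just b' → b < b'
    strict' a a' b b' a<a' eq eq' with update-just⁻¹ eq | update-just⁻¹ eq'
    ... | inj₁ (refl , _) | inj₁ (refl , _) = ⊥-elim (<-irrefl refl a<a')
    ... | inj₁ (refl , refl) | inj₂ (a'≢s , Qa') with away a'≢s Qa'
    ...   | inj₁ (a'<s , _) = ⊥-elim (<-asym a<a' a'<s)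
    ...   | inj₂ (_ , 1+c<b') = <-trans (n<1+n c) 1+c<b'
    strict' a a' b b' a<a' eq eq' | inj₂ (a≢s , Qa) | inj₁ (refl , refl) with away a≢s Qa
    ...   | inj₁ (a<s , refl) = <-≤-trans a<s s≤c
    ...   | inj₂ (s<a , _) = ⊥-elim (<-asym a<a' s<a)
    strict' a a' b b' a<a' eq eq' | inj₂ (_ , Qa) | inj₂ (_ , Qa') = strict a a' b b' a<a' Qa Qa'

-- Scanning s = 0,…,r: once Q fixes {0,…,s-1}, lower Q s step by step to s
-- (each step peels off an f_j), then move on to s + 1; at the end Q is the
-- identity on {0,…,r}.
increasing-generated : ∀ {n r Q} → r ≤ n → StrictlyIncreasing n r Q → Generated n Q
increasing-generated {n} {r} r≤n inc = scan (suc r) 0 (+-identityʳ (suc r)) inc (λ _ ())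
  where
  scan : ∀ d s {Q} → d + s ≡ suc r → StrictlyIncreasing n r Q → FixesBelow s Q → Generated n Q
  scan zero _ {Q} refl inc fix = generated-≗ Q≗restrict (restrict-generated r≤n)
    where
    Q≗restrict : Q ≗ restrict r
    Q≗restrict a with a ≤? r
    ... | yes a≤r = trans (fix a (s≤s a≤r)) (sym (restrict-in a≤r))
    ... | no a≰r =
      trans (StrictlyIncreasing.undefined inc a (≰⇒> a≰r)) (sym (restrict-above (≰⇒> a≰r)))
  scan (suc d) s {Q} 1+d+s≡1+r inc fix = start (StrictlyIncreasing.defined inc s s≤r)
    where
    s≤r : s ≤ r
    s≤r = subst (s ≤_) (suc-injective 1+d+s≡1+r) (m≤n+m s d)
    climb : ∀ e {Q} → StrictlyIncreasing n r Q → FixesBelow s Q → Q s ≡ just (e + s) → Generated n Q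
    climb zero inc fix Qs = scan d (suc s) (trans (+-suc d s) 1+d+s≡1+r) inc fix'
      where
      fix' : FixesBelow (suc s) _
      fix' a a<1+s with m≤n⇒m<n∨m≡n (≤-pred a<1+s)
      ... | inj₁ a<s = fix a a<s
      ... | inj₂ refl = Qs
    climb (suc e) inc fix Qs =
      generated-≗ factor
        (generated-∘ (generated-f 1+c≤n) (climb e lowered-increasing lowered-fixes lowered-at))
      where open Lowering inc fix s≤r (m≤n+m s e) Qs
    start : Defined Q s → Generated n Q
    start (v , Qs) = climb (v ∸ s) inc fix
      (subst (λ u → Q s ≡ just u) (sym (m∸n+n≡m (above-diagonal inc fix Qs))) Qs)

precompose-hom : ∀ {n P} (σ : ℕ → ℕ) → IsHalfHom n P →
                 (∀ {a a'} → a ≤ a' → σ a ≤ σ a') →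
                 (∀ a b → P (σ a) ≡ just b → a ≤ n) →
                 FixesZero (P ∘ σ) →
                 (∀ {a a'} → a < a' → σ a ≡ σ a' → σ a ≡ 0) →
                 IsHalfHom n (P ∘ σ)
precompose-hom {n} {P} σ hom σ-mono dom-bound' fixes-zero' σ-collapse = record
  { dom-bound = dom-bound'
  ; img-bound = λ a → img-bound (σ a)
  ; fixes-zero = fixes-zero'
  ; monotone = λ a a' b b' eq eq' a≤a' → monotone (σ a) (σ a') b b' eq eq' (σ-mono a≤a')
  ; collapses-to-zero = collapses-to-zero'
  }
  where
  open IsHalfHom hom
  collapses-to-zero' : ∀ a a' b → P (σ a) ≡ just b → P (σ a') ≡ just b → a < a' → b ≡ 0
  collapses-to-zero' a a' b eq eq' a<a' with m≤n⇒m<n∨m≡n (σ-mono (<⇒≤ a<a'))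
  ... | inj₁ σa<σa' = collapses-to-zero (σ a) (σ a') b eq eq' σa<σa'
  ... | inj₂ σa≡σa' = fixes-zero b (subst (λ u → P u ≡ just b) (σ-collapse a<a' σa≡σa') eq)

collapse-hom : ∀ {n P} → IsHalfHom n P → P 1 ≡ just 0 → IsHalfHom n (P ∘ suc)
collapse-hom {n} {P} hom P1≡0 = precompose-hom suc hom s≤s
  (λ a b eq → ≤-pred (m≤n⇒m≤1+n (IsHalfHom.dom-bound hom (suc a) b eq)))
  (λ b eq → sym (just-injective (trans (sym P1≡0) eq)))
  (λ a<a' 1+a≡1+a' → ⊥-elim (<⇒≢ a<a' (suc-injective 1+a≡1+a')))

collapse-factor : ∀ {n P} → IsHalfHom n P → P 0 ≡ just 0 → P 1 ≡ just 0 →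
                  P ≗ (P ∘ suc) ∘ʰ gHalf n
collapse-factor {n} {P} hom P0≡0 P1≡0 a with a ≤? n
... | no a≰n = trans (hom-above hom (≰⇒> a≰n)) (sym (∘ʰ-nothing (gHalf-above (≰⇒> a≰n))))
... | yes a≤n = sym (trans (∘ʰ-just (gHalf-in a≤n)) (at a))
  where
  at : ∀ a → P (suc (pred a)) ≡ P a
  at zero = trans P1≡0 (sym P0≡0)
  at (suc a) = refl

hom-increasing : ∀ {n r P} → IsHalfHom n P → HasDomain r P → (∀ b → P 1 ≡ just b → b ≢ 0) →
                 StrictlyIncreasing n r P
hom-increasing {n} {r} {P} hom dom P1≢0 = record
  { domain = dom
  ; zero↦zero = domain-fixes-zero hom dom
  ; img-bound = img-bound
  ; strict = strict
  }
  where
  open IsHalfHom hom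
  open HasDomain dom
  -- If a < a' had the same image b, then b = 0 and 1 ↦ 0 by monotonicity.
  strict : ∀ a a' b b' → a < a' → P a ≡ just b → P a' ≡ just b' → b < b'
  strict a a' b b' a<a' Pa Pa' with b ≟ b'
  ... | no b≢b' = ≤∧≢⇒< (monotone a a' b b' Pa Pa' (<⇒≤ a<a')) b≢b'
  ... | yes refl with defined 1 (≤-trans (≤-trans (s≤s z≤n) a<a') (domain-bound dom Pa'))
  ...   | c , P1 = ⊥-elim (P1≢0 c P1 (n≤0⇒n≡0 (subst (c ≤_) (collapses-to-zero a a' b Pa Pa' a<a')
                                        (monotone 1 a' c b P1 Pa' (≤-trans (s≤s z≤n) a<a')))))

-- Every half homomorphism with domain {0,…,r} is generated: peel off g while
-- 1 ↦ 0, then use that the rest is strictly increasing.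
domain-generated : ∀ r {n P} → r ≤ n → IsHalfHom n P → HasDomain r P → Generated n P
domain-generated zero r≤n hom dom =
  increasing-generated r≤n
    (hom-increasing hom dom (λ b P1 → ⊥-elim (<⇒≱ ≤-refl (domain-bound dom P1))))
domain-generated (suc r) {n} {P} r≤n hom dom with HasDomain.defined dom 1 (s≤s z≤n)
... | suc b , P1 = increasing-generated r≤n
        (hom-increasing hom dom (λ b' P1' → subst (_≢ 0) (just-injective (trans (sym P1) P1')) λ ()))
... | zero , P1≡0 = generated-≗ (collapse-factor hom (domain-fixes-zero hom dom) P1≡0)
        (generated-∘ (domain-generated r (<⇒≤ r≤n) (collapse-hom hom P1≡0) dom') generated-g)
  where
  dom' : HasDomain r (P ∘ suc)
  dom' = record { defined = λ a a≤r → HasDomain.defined dom (suc a) (s≤s a≤r)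
                ; undefined = λ a r<a → HasDomain.undefined dom (suc a) (s≤s r<a) }

DefinedBelow : ℕ → Half → Set
DefinedBelow j P = ∀ a → a < j → Defined P a

-- A hole at 0 is filled by 0 ↦ 0, at the cost of a factor f_0.
fill-zero-hom : ∀ {n P} → IsHalfHom n P → IsHalfHom n (update P 0 0)
fill-zero-hom {n} {P} hom = record
  { dom-bound = dom-bound'
  ; img-bound = img-bound'
  ; fixes-zero = λ b eq → sym (just-injective (trans (sym update-here) eq))
  ; monotone = monotone'
  ; collapses-to-zero = collapses-to-zero'
  }
  where
  open IsHalfHom hom
  dom-bound' : ∀ a b → update P 0 0 a ≡ just b → a ≤ n
  dom-bound' a b eq with update-just⁻¹ eq
  ... | inj₁ (refl , _) = z≤n
  ... | inj₂ (_ , Pa) = dom-bound a b Pa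
  img-bound' : ∀ a b → update P 0 0 a ≡ just b → b ≤ n
  img-bound' a b eq with update-just⁻¹ eq
  ... | inj₁ (_ , refl) = z≤n
  ... | inj₂ (_ , Pa) = img-bound a b Pa
  monotone' : ∀ a a' b b' → update P 0 0 a ≡ just b → update P 0 0 a' ≡ just b' → a ≤ a' → b ≤ b'
  monotone' a a' b b' eq eq' a≤a' with update-just⁻¹ eq | update-just⁻¹ eq'
  ... | inj₁ (_ , refl) | _ = z≤n
  ... | inj₂ (a≢0 , _) | inj₁ (refl , _) = ⊥-elim (a≢0 (n≤0⇒n≡0 a≤a'))
  ... | inj₂ (_ , Pa) | inj₂ (_ , Pa') = monotone a a' b b' Pa Pa' a≤a'
  collapses-to-zero' : ∀ a a' b → update P 0 0 a ≡ just b → update P 0 0 a' ≡ just b →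
                       a < a' → b ≡ 0
  collapses-to-zero' a a' b eq eq' a<a' with update-just⁻¹ eq | update-just⁻¹ eq'
  ... | inj₁ (_ , refl) | _ = refl
  ... | inj₂ _ | inj₁ (refl , _) = ⊥-elim (<⇒≱ a<a' z≤n)
  ... | inj₂ (_ , Pa) | inj₂ (_ , Pa') = collapses-to-zero a a' b Pa Pa' a<a'

fill-zero-factor : ∀ {n P} → IsHalfHom n P → P 0 ≡ nothing → P ≗ update P 0 0 ∘ʰ fHalf n 0
fill-zero-factor hom P0 zero = trans P0 (sym (∘ʰ-nothing (fHalf-kill 0)))
fill-zero-factor {n} hom P0 (suc a) with suc a ≤? n
... | yes 1+a≤n = sym (trans (∘ʰ-just (fHalf-fix 0 1+a≤n (inj₂ (s≤s z≤n)))) (update-there (λ ())))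
... | no 1+a≰n = trans (hom-above hom (≰⇒> 1+a≰n)) (sym (∘ʰ-nothing (fHalf-above 0 (≰⇒> 1+a≰n))))

opaque
  lower : ℕ → ℕ → ℕ
  lower j a = if ⌊ a ≤? j ⌋ then pred a else a

opaque
  unfolding lower

  lower-low : ∀ {j a} → a ≤ j → lower j a ≡ pred a
  lower-low {j} {a} a≤j with a ≤? j
  ... | yes _ = refl
  ... | no a≰j = ⊥-elim (a≰j a≤j)

  lower-high : ∀ {j a} → j < a → lower j a ≡ a
  lower-high {j} {a} j<a with a ≤? j
  ... | yes a≤j = ⊥-elim (<⇒≱ j<a a≤j)
  ... | no _ = refl

lower-cases : ∀ j a → (a ≤ j × lower j a ≡ pred a) ⊎ (j < a × lower j a ≡ a)
lower-cases j a with a ≤? j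
... | yes a≤j = inj₁ (a≤j , lower-low a≤j)
... | no a≰j = inj₂ (≰⇒> a≰j , lower-high (≰⇒> a≰j))

lower-monotone : ∀ j {a a'} → a ≤ a' → lower j a ≤ lower j a'
lower-monotone j {a} {a'} a≤a' with lower-cases j a | lower-cases j a'
... | inj₁ (_ , la) | inj₁ (_ , la') rewrite la | la' = pred-mono-≤ a≤a'
... | inj₁ (_ , la) | inj₂ (_ , la') rewrite la | la' = ≤-trans pred[n]≤n a≤a'
... | inj₂ (j<a , _) | inj₁ (a'≤j , _) = ⊥-elim (<⇒≱ j<a (≤-trans a≤a' a'≤j))
... | inj₂ (_ , la) | inj₂ (_ , la') rewrite la | la' = a≤a'

lower-collapse : ∀ j {a a'} → a < a' → lower j a ≡ lower j a' → lower j a ≡ 0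
lower-collapse j {a} {a'} a<a' eq with lower-cases j a | lower-cases j a'
... | inj₁ (_ , la) | inj₁ (_ , la') = trans la (pred-equal a<a' (trans (sym la) (trans eq la')))
  where
  pred-equal : ∀ {a a'} → a < a' → pred a ≡ pred a' → pred a ≡ 0
  pred-equal {zero} _ _ = refl
  pred-equal {suc a} {suc a'} a<a' eq = ⊥-elim (<⇒≢ (≤-pred a<a') eq)
... | inj₁ (_ , la) | inj₂ (_ , la') =
  ⊥-elim (<⇒≢ (≤-<-trans pred[n]≤n a<a') (trans (sym la) (trans eq la')))
... | inj₂ (j<a , la) | inj₁ (a'≤j , _) = ⊥-elim (<⇒≱ j<a (<⇒≤ (<-≤-trans a<a' a'≤j)))
... | inj₂ (_ , la) | inj₂ (_ , la') = ⊥-elim (<⇒≢ a<a' (trans (sym la) (trans eq la')))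

-- A hole at j = k + 1 is filled by precomposing with lower j (which sends
-- 1 to 0), at the cost of a factor shift_k.
fill-hole-hom : ∀ {n P} k → suc k ≤ n → IsHalfHom n P → IsHalfHom n (P ∘ lower (suc k))
fill-hole-hom {n} {P} k 1+k≤n hom = precompose-hom (lower (suc k)) hom (lower-monotone (suc k)) dom-bound'
  (λ b eq → IsHalfHom.fixes-zero hom b (trans (cong P (sym (lower-low z≤n))) eq))
  (lower-collapse (suc k))
  where
  dom-bound' : ∀ a b → P (lower (suc k) a) ≡ just b → a ≤ n
  dom-bound' a b eq with lower-cases (suc k) a
  ... | inj₁ (a≤1+k , _) = ≤-trans a≤1+k 1+k≤n
  ... | inj₂ (_ , la) = IsHalfHom.dom-bound hom a b (subst (λ u → P u ≡ just b) la eq)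

fill-hole-defined : ∀ {P} k → DefinedBelow (suc k) P → DefinedBelow (suc (suc k)) (P ∘ lower (suc k))
fill-hole-defined k def a a<2+k rewrite lower-low (≤-pred a<2+k) =
  def (pred a) (s≤s (pred-mono-≤ (≤-pred a<2+k)))

fill-hole-factor : ∀ {n P} k → suc k ≤ n → IsHalfHom n P → P (suc k) ≡ nothing →
                   P ≗ (P ∘ lower (suc k)) ∘ʰ shift n k
fill-hole-factor {n} {P} k 1+k≤n hom P1+k a = by-cases (<-cmp a (suc k))
  where
  P' = P ∘ lower (suc k)
  by-cases : Tri (a < suc k) (a ≡ suc k) (suc k < a) → P a ≡ (P' ∘ʰ shift n k) a
  by-cases (tri< a<1+k _ _) = sym (low a (≤-pred a<1+k))
    where
    low : ∀ a → a ≤ k → (P' ∘ʰ shift n k) a ≡ P a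
    low zero _ = trans (∘ʰ-just (shift-zero k)) (cong P (lower-low z≤n))
    low (suc a) 1+a≤k =
      trans (∘ʰ-just (shift-low k 1+k≤n (s≤s z≤n) 1+a≤k)) (cong P (lower-low (s≤s 1+a≤k)))
  by-cases (tri≈ _ refl _) = trans P1+k (sym (∘ʰ-nothing (shift-gap k)))
  by-cases (tri> _ _ 1+k<a) with a ≤? n
  ... | yes a≤n = sym (trans (∘ʰ-just (shift-high k 1+k<a a≤n)) (cong P (lower-high 1+k<a)))
  ... | no a≰n = trans (hom-above hom (≰⇒> a≰n)) (sym (∘ʰ-nothing (shift-above k (≰⇒> a≰n))))

-- Scanning j = 0,…,n, each hole is filled; at the end the domain is {0,…,n}.
holes-generated : ∀ {n} d j {P} → d + j ≡ suc n → IsHalfHom n P → DefinedBelow j P → Generated n P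
holes-generated {n} zero j refl hom def = domain-generated n ≤-refl hom (record
  { defined = λ a a≤n → def a (s≤s a≤n) ; undefined = λ a n<a → hom-above hom n<a })
holes-generated {n} (suc d) j {P} 1+d+j≡1+n hom def with P j in Pj
... | just b = holes-generated d (suc j) (trans (+-suc d j) 1+d+j≡1+n) hom def'
  where
  def' : DefinedBelow (suc j) P
  def' a a<1+j with m≤n⇒m<n∨m≡n (≤-pred a<1+j)
  ... | inj₁ a<j = def a a<j
  ... | inj₂ refl = b , Pj
holes-generated (suc d) zero {P} 1+d≡1+n hom def | nothing = generated-≗ (fill-zero-factor hom Pj)
  (generated-∘ (holes-generated d 1 (trans (+-suc d 0) 1+d≡1+n) (fill-zero-hom hom) def') (generated-f z≤n))
  where
  def' : DefinedBelow 1 (update P 0 0)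
  def' zero _ = 0 , update-here
  def' (suc _) (s≤s ())
holes-generated {n} (suc d) (suc k) 1+d+j≡1+n hom def | nothing =
  generated-≗ (fill-hole-factor k 1+k≤n hom Pj)
    (generated-∘ (holes-generated d (suc (suc k)) (trans (+-suc d (suc k)) 1+d+j≡1+n)
                                  (fill-hole-hom k 1+k≤n hom) (fill-hole-defined k def))
                 (generated-shift k 1+k≤n))
  where
  1+k≤n : suc k ≤ n
  1+k≤n = subst (suc k ≤_) (suc-injective 1+d+j≡1+n) (m≤n+m (suc k) d)

hom-generated : ∀ {n P} → IsHalfHom n P → Generated n P
hom-generated {n} hom = holes-generated (suc n) 0 (+-identityʳ (suc n)) hom (λ _ ())

-- The half map of h is computed by a word w; extending both to ℤ gives h = w.
-- (The argument does not need the hypothesis 1 ≤ n.)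
proposition2p9 : (n : ℕ) → 1 ≤ n → (h : PMap) → IsPartialEndo n h →
    ∃ λ (w : List (Gen n)) → ∀ (a : ℤ) → h a ≡ evalWord n w a
proposition2p9 n _ h pe = w , λ a → begin
  h a                         ≡⟨ h-extend a ⟩
  extend (positivePart h) a   ≡⟨ extend-cong P≗w a ⟩
  extend (evalHalf n w) a     ≡⟨ sym (evalWord-extend n w a) ⟩
  evalWord n w a              ∎
  where
  open ≡-Reasoning
  open PartialEndo pe
  w = proj₁ (hom-generated positivePart-hom)
  P≗w = proj₂ (hom-generated positivePart-hom)
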